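{- If $G$ is a graph of order $n$, minimum degree $\delta \ge 1$, and maximum degree $\Delta$, then \[ \gamma_e(G) \ge \left(\frac{\delta}{\Delta + \delta - 1}\right)\mu(G). \]
   Context: All graphs are finite, simple and undirected. A matching is a set of pairwise vertex-disjoint edges; $\mu(G)$ is the maximum cardinality of a matching of $G$. The edge domination number $\gamma_e(G)$ is the minimum cardinality of a maximal (with respect to inclusion) matching of $G$. -}

module Defs where

open import Data.Nat using (ℕ; _≤_; _*_; _+_; _∸_)
open import Data.Fin using (Fin)
open import Data.Bool using (Bool; true; false)
open import Data.List using (List; length; filter)
open import Data.List.Membership.Propositional using (_∈_)
open import Data.Product using (Σ; _×_; _,_; ∃)
open import Data.Sum using (_⊎_)
open import Relation.Binary.PropositionalEquality using (_≡_)
open import Relation.Nullary using (¬_)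
open import Data.Fin.Subset using (Subset; ∣_∣)
open import Data.Vec using (tabulate)
open import Data.List.Relation.Unary.Unique.Propositional using (Unique)

record Graph (n : ℕ) : Set where
  field
    adj   : Fin n → Fin n → Bool
    sym   : ∀ u v → adj u v ≡ adj v u
    irref : ∀ v → adj v v ≡ false
open Graph public

Adj : ∀ {n} → Graph n → Fin n → Fin n → Set
Adj G u v = adj G u v ≡ true

nbhd : ∀ {n} → Graph n → Fin n → Subset n
nbhd G v = tabulate (adj G v)

deg : ∀ {n} → Graph n → Fin n → ℕ
deg G v = ∣ nbhd G v ∣

IsMinDegree : ∀ {n} → Graph n → ℕ → Set
IsMinDegree {n} G d = (∃ λ (v : Fin n) → deg G v ≡ d) × (∀ v → d ≤ deg G v)

IsMaxDegree : ∀ {n} → Graph n → ℕ → Set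
IsMaxDegree {n} G d = (∃ λ (v : Fin n) → deg G v ≡ d) × (∀ v → deg G v ≤ d)

Edge : ℕ → Set
Edge n = Fin n × Fin n

_touches_ : ∀ {n} → Edge n → Fin n → Set
(a , b) touches v = (a ≡ v) ⊎ (b ≡ v)

_meets_ : ∀ {n} → Edge n → Edge n → Set
(a , b) meets e = (e touches a) ⊎ (e touches b)

-- A matching: a list of edges of G, listed without repetition,
-- such that distinct entries are vertex-disjoint.
-- (Uniqueness plus pairwise disjointness means each edge appears once,
--  in one orientation; its length is the number of edges.)
record IsMatching {n} (G : Graph n) (M : List (Edge n)) : Set where
  field
    edges    : ∀ {u v} → (u , v) ∈ M → Adj G u v
    distinct : Unique M
    disjoint : ∀ {e f} → e ∈ M → f ∈ M → e meets f → e ≡ f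

IsMaximalMatching : ∀ {n} → Graph n → List (Edge n) → Set
IsMaximalMatching {n} G M =
  IsMatching G M ×
  (∀ (u v : Fin n) → Adj G u v → ∃ λ e → e ∈ M × (u , v) meets e)

IsMatchingNumber : ∀ {n} → Graph n → ℕ → Set
IsMatchingNumber {n} G k =
  (∃ λ M → IsMatching G M × length M ≡ k) ×
  (∀ M → IsMatching G M → length M ≤ k)

IsEdgeDominationNumber : ∀ {n} → Graph n → ℕ → Set
IsEdgeDominationNumber {n} G k =
  (∃ λ M → IsMaximalMatching G M × length M ≡ k) ×
  (∀ M → IsMaximalMatching G M → k ≤ length M)

-- Let M be a matching and D a maximal matching, C the vertices covered by D
-- and A those covered by M but not by D, so that 2|M| ≤ |C| + |A| = 2|D| + |A|.
-- By maximality of D every neighbour of a vertex of A lies in C, while every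
-- vertex of C has its D-partner in C and hence at most Δ − 1 neighbours in A;
-- counting the edges between A and C gives δ|A| ≤ (Δ − 1)|C| = 2(Δ − 1)|D|.
-- Together, δ|M| ≤ (Δ + δ − 1)|D|; take M maximum and D minimum maximal.

module Submission where

open import Defs hiding (sym)
open import Data.Bool using (Bool; true; false; _∧_; _∨_; not)
open import Data.Bool.ListAction using (any)
open import Data.Bool.Properties using (¬-not; ∨-zeroʳ)
open import Data.Fin using (Fin; zero; suc)
open import Data.Fin.Properties using (_≟_)
open import Data.Fin.Subset using (∣_∣)
open import Data.List using (List; []; _∷_; length)
open import Data.List.Membership.Propositional using (_∈_)
open import Data.List.Relation.Unary.All as All using ()
open import Data.List.Relation.Unary.AllPairs as AllPairs using ()
open import Data.List.Relation.Unary.Any using (here; there)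
open import Data.Nat using (ℕ; zero; suc; _≤_; _<_; _*_; _+_; _∸_; z≤n; s≤s⁻¹)
open import Data.Nat.Properties hiding (_≟_)
open import Data.Product using (_×_; _,_; ∃; proj₁; proj₂)
open import Data.Sum using (inj₁; inj₂)
open import Data.Vec using (tabulate)
open import Data.Vec.Functional using (Vector)
open import Function using (_∘_; case_of_)
open import Relation.Binary.PropositionalEquality
open import Relation.Nullary using (¬_; yes; no; does)
open import Relation.Nullary.Decidable using (dec-true; dec-false)

open import Algebra.Properties.Semiring.Sum +-*-semiring
  using (sum; sum-syntax; ∑-comm; ∑-distrib-+; sum-cong-≗; sum-replicate-zero; *-distribʳ-sum)

𝟙 : Bool → ℕ
𝟙 true  = 1
𝟙 false = 0

size : ∀ {n} → (Fin n → Bool) → ℕ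
size p = sum (𝟙 ∘ p)

sum-mono-≤ : ∀ {n} {f g : Vector ℕ n} → (∀ i → f i ≤ g i) → sum f ≤ sum g
sum-mono-≤ {zero}  f≤g = z≤n
sum-mono-≤ {suc n} f≤g = +-mono-≤ (f≤g zero) (sum-mono-≤ (f≤g ∘ suc))

∣tabulate∣≡size : ∀ {n} (p : Fin n → Bool) → ∣ tabulate p ∣ ≡ size p
∣tabulate∣≡size {zero}  p = refl
∣tabulate∣≡size {suc n} p with p zero
... | true  = cong suc (∣tabulate∣≡size (p ∘ suc))
... | false = ∣tabulate∣≡size (p ∘ suc)

size-≡0 : ∀ {n} {p : Fin n → Bool} → (∀ v → p v ≡ false) → size p ≡ 0
size-≡0 {n} p≡false = trans (sum-cong-≗ (cong 𝟙 ∘ p≡false)) (sum-replicate-zero n)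

size-≟ : ∀ {n} (a : Fin n) → size (λ v → does (a ≟ v)) ≡ 1
size-≟ {suc n} zero = cong suc (size-≡0 {n} λ _ → refl)
size-≟ {suc n} (suc a) = size-≟ a

𝟙-∨-disjoint : ∀ x y → (x ≡ true → y ≡ false) → 𝟙 (x ∨ y) ≡ 𝟙 x + 𝟙 y
𝟙-∨-disjoint true  y x⇒¬y rewrite x⇒¬y refl = refl
𝟙-∨-disjoint false y _    = refl

𝟙-∧-≤ : ∀ x y → 𝟙 (x ∧ y) ≤ 𝟙 y
𝟙-∧-≤ true  y = ≤-refl
𝟙-∧-≤ false y = z≤n

𝟙-≤-∧-not : ∀ x y → 𝟙 x ≤ 𝟙 y + 𝟙 (x ∧ not y)
𝟙-≤-∧-not true  true  = ≤-refl
𝟙-≤-∧-not true  false = ≤-refl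
𝟙-≤-∧-not false y     = z≤n

module _ {n} (p q : Fin n → Bool) where

  size-∨-disjoint : (∀ v → p v ≡ true → q v ≡ false) →
                    size (λ v → p v ∨ q v) ≡ size p + size q
  size-∨-disjoint disjoint =
    trans (sum-cong-≗ (λ v → 𝟙-∨-disjoint (p v) (q v) (disjoint v)))
          (∑-distrib-+ (𝟙 ∘ p) (𝟙 ∘ q))

  size-≤-∧-not : size p ≤ size q + size (λ v → p v ∧ not (q v))
  size-≤-∧-not = ≤-trans (sum-mono-≤ (λ v → 𝟙-≤-∧-not (p v) (q v)))
                         (≤-reflexive (∑-distrib-+ (𝟙 ∘ q) _))

  size-∧-< : ∀ {t} → q t ≡ true → p t ≡ false → size (λ v → p v ∧ q v) < size q
  size-∧-< {t} qt pt = begin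
    suc (size p∧q)                              ≡⟨ +-comm 1 (size p∧q) ⟩
    size p∧q + 1                                ≡⟨ cong (size p∧q +_) (sym (size-≟ t)) ⟩
    size p∧q + size (λ v → does (t ≟ v))        ≡⟨ sym (∑-distrib-+ (𝟙 ∘ p∧q) _) ⟩
    ∑[ v < n ] (𝟙 (p∧q v) + 𝟙 (does (t ≟ v)))  ≤⟨ sum-mono-≤ pointwise ⟩
    size q                                      ∎
    where
    open ≤-Reasoning
    p∧q : Fin n → Bool
    p∧q v = p v ∧ q v
    pointwise : ∀ v → 𝟙 (p∧q v) + 𝟙 (does (t ≟ v)) ≤ 𝟙 (q v)
    pointwise v with t ≟ v
    ... | yes refl rewrite pt | qt = ≤-refl
    ... | no _     = ≤-trans (≤-reflexive (+-identityʳ _)) (𝟙-∧-≤ (p v) (q v))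

endpoint : ∀ {n} → Edge n → Fin n → Bool
endpoint (a , b) v = does (a ≟ v) ∨ does (b ≟ v)

covered : ∀ {n} → List (Edge n) → Fin n → Bool
covered M v = any (λ e → endpoint e v) M

module _ {n : ℕ} where

  endpoint⇒touches : ∀ (e : Edge n) {v} → endpoint e v ≡ true → e touches v
  endpoint⇒touches (a , b) {v} ev with a ≟ v | b ≟ v
  ... | yes a≡v | _       = inj₁ a≡v
  ... | no _    | yes b≡v = inj₂ b≡v
  endpoint⇒touches (a , b) () | no _ | no _

  touches⇒endpoint : ∀ (e : Edge n) {v} → e touches v → endpoint e v ≡ true
  touches⇒endpoint (a , b) {v} (inj₁ a≡v) rewrite dec-true (a ≟ v) a≡v = refl
  touches⇒endpoint (a , b) {v} (inj₂ b≡v) rewrite dec-true (b ≟ v) b≡v = ∨-zeroʳ _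

  touches⇒meets : ∀ {e f : Edge n} {v} → e touches v → f touches v → e meets f
  touches⇒meets (inj₁ refl) f-v = inj₁ f-v
  touches⇒meets (inj₂ refl) f-v = inj₂ f-v

  covered⇒touching : ∀ M {v} → covered M v ≡ true → ∃ λ (e : Edge n) → e ∈ M × e touches v
  covered⇒touching (e ∷ M) {v} Mv with endpoint e v in ev
  ... | true  = e , here refl , endpoint⇒touches e ev
  ... | false with covered⇒touching M Mv
  ...   | f , f∈M , f-v = f , there f∈M , f-v

  touching⇒covered : ∀ {M} {e : Edge n} {v} → e ∈ M → e touches v → covered M v ≡ true
  touching⇒covered {e = e} (here refl) e-v rewrite touches⇒endpoint e e-v = refl
  touching⇒covered {M = f ∷ M} {v = v} (there e∈M) e-v
    rewrite touching⇒covered e∈M e-v = ∨-zeroʳ (endpoint f v)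

  size-endpoint : ∀ {a b : Fin n} → a ≢ b → size (endpoint (a , b)) ≡ 2
  size-endpoint {a} {b} a≢b =
    trans (size-∨-disjoint (does ∘ (a ≟_)) (does ∘ (b ≟_)) not-both) (cong₂ _+_ (size-≟ a) (size-≟ b))
    where
    not-both : ∀ v → does (a ≟ v) ≡ true → does (b ≟ v) ≡ false
    not-both v _ with a ≟ v
    not-both v () | no _
    ... | yes refl = dec-false (b ≟ a) (a≢b ∘ sym)

module _ {n} (G : Graph n) where

  Adj-sym : ∀ {u v} → Adj G u v → Adj G v u
  Adj-sym {u} {v} uv = trans (Graph.sym G v u) uv

  Adj-irrefl : ∀ {u v} → Adj G u v → u ≢ v
  Adj-irrefl {u} uv refl with () ← trans (sym (irref G u)) uv

  matching-tail : ∀ {e M} → IsMatching G (e ∷ M) → IsMatching G M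
  matching-tail m = record
    { edges    = IsMatching.edges m ∘ there
    ; distinct = AllPairs.tail (IsMatching.distinct m)
    ; disjoint = λ e∈M f∈M → IsMatching.disjoint m (there e∈M) (there f∈M)
    }

  matching-head-apart : ∀ {e f M} → IsMatching G (e ∷ M) → f ∈ M → ¬ e meets f
  matching-head-apart m f∈M e-f =
    All.lookup (AllPairs.head (IsMatching.distinct m)) f∈M
      (IsMatching.disjoint m (here refl) (there f∈M) e-f)

  size-covered : ∀ {M} → IsMatching G M → size (covered M) ≡ 2 * length M
  size-covered {[]}    _ = size-≡0 {n} λ _ → refl
  size-covered {e@(a , b) ∷ M} m = begin
    size (covered (e ∷ M))               ≡⟨ size-∨-disjoint (endpoint e) (covered M) uncovered-by-tail ⟩
    size (endpoint e) + size (covered M) ≡⟨ cong₂ _+_ (size-endpoint (Adj-irrefl (IsMatching.edges m (here refl))))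
                                                      (size-covered (matching-tail m)) ⟩
    2 + 2 * length M                     ≡⟨ *-suc 2 (length M) ⟨
    2 * length (e ∷ M)                   ∎
    where
    open ≡-Reasoning
    uncovered-by-tail : ∀ v → endpoint e v ≡ true → covered M v ≡ false
    uncovered-by-tail v ev = ¬-not λ Mv →
      let f , f∈M , f-v = covered⇒touching M Mv
      in matching-head-apart m f∈M (touches⇒meets (endpoint⇒touches e ev) f-v)

module _ {n} {G : Graph n} {D : List (Edge n)} (D-maximal : IsMaximalMatching G D) where

  neighbour-of-uncovered-covered : ∀ {u v} → Adj G u v → covered D u ≡ false → covered D v ≡ true
  neighbour-of-uncovered-covered {u} {v} uv Du≡false with proj₂ D-maximal u v uv
  ... | f , f∈D , inj₁ f-u with () ← trans (sym Du≡false) (touching⇒covered f∈D f-u)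
  ... | f , f∈D , inj₂ f-v = touching⇒covered f∈D f-v

  covered-neighbour : ∀ {s} → covered D s ≡ true → ∃ λ t → Adj G s t × covered D t ≡ true
  covered-neighbour Ds with covered⇒touching D Ds
  ... | (s , t) , st∈D , inj₁ refl = t , IsMatching.edges (proj₁ D-maximal) st∈D , touching⇒covered st∈D (inj₂ refl)
  ... | (t , s) , ts∈D , inj₂ refl = t , Adj-sym G (IsMatching.edges (proj₁ D-maximal) ts∈D) , touching⇒covered ts∈D (inj₁ refl)

  size-uncovered*δ≤size-covered*[Δ-1] :
    ∀ {δ Δ-1} (A : Fin n → Bool) → (∀ a → A a ≡ true → covered D a ≡ false) →
    (∀ v → δ ≤ deg G v) → (∀ v → deg G v ≤ suc Δ-1) →
    size A * δ ≤ size (covered D) * Δ-1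
  size-uncovered*δ≤size-covered*[Δ-1] {δ} {Δ-1} A A-uncovered δ≤deg deg≤Δ = begin
    size A * δ                                  ≡⟨ *-distribʳ-sum δ (𝟙 ∘ A) ⟩
    ∑[ a < n ] (𝟙 (A a) * δ)                    ≤⟨ sum-mono-≤ degree-of-A ⟩
    ∑[ a < n ] ∑[ s < n ] 𝟙 (A a ∧ adj G a s)   ≡⟨ ∑-comm (λ a s → 𝟙 (A a ∧ adj G a s)) ⟩
    ∑[ s < n ] ∑[ a < n ] 𝟙 (A a ∧ adj G a s)   ≤⟨ sum-mono-≤ neighbours-in-A ⟩
    ∑[ s < n ] (𝟙 (covered D s) * Δ-1)         ≡⟨ *-distribʳ-sum Δ-1 (𝟙 ∘ covered D) ⟨
    size (covered D) * Δ-1                     ∎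
    where
    open ≤-Reasoning

    degree-of-A : ∀ a → 𝟙 (A a) * δ ≤ size (λ s → A a ∧ adj G a s)
    degree-of-A a with A a
    ... | true  = begin
      1 * δ           ≡⟨ *-identityˡ δ ⟩
      δ               ≤⟨ δ≤deg a ⟩
      deg G a         ≡⟨ ∣tabulate∣≡size (adj G a) ⟩
      size (adj G a)  ∎
    ... | false = z≤n

    not-in-A : ∀ {t} → covered D t ≡ true → A t ≡ false
    not-in-A Dt = ¬-not λ At → case trans (sym (A-uncovered _ At)) Dt of λ ()

    neighbours-in-A : ∀ s → size (λ a → A a ∧ adj G a s) ≤ 𝟙 (covered D s) * Δ-1
    neighbours-in-A s with covered D s in Ds
    ... | false = ≤-reflexive (size-≡0 {n} no-edge)
      where
      no-edge : ∀ a → A a ∧ adj G a s ≡ false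
      no-edge a with A a in Aa | adj G a s in as
      ... | false | _     = refl
      ... | true  | false = refl
      ... | true  | true  with () ← trans (sym Ds) (neighbour-of-uncovered-covered as (A-uncovered a Aa))
    ... | true with covered-neighbour Ds
    ...   | t , st , Dt = s≤s⁻¹ (begin-strict
      size (λ a → A a ∧ adj G a s)  ≡⟨ sum-cong-≗ (λ a → cong (𝟙 ∘ (A a ∧_)) (Graph.sym G a s)) ⟩
      size (λ a → A a ∧ adj G s a)  <⟨ size-∧-< A (adj G s) st (not-in-A Dt) ⟩
      size (adj G s)                ≡⟨ ∣tabulate∣≡size (adj G s) ⟨
      deg G s                       ≤⟨ deg≤Δ s ⟩
      suc Δ-1                       ≡⟨ cong suc (*-identityˡ Δ-1) ⟨
      suc (1 * Δ-1)                 ∎)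

k≤c+x∧x*δ≤c*d⇒k*δ≤c*[d+δ] : ∀ {k c x δ d} → k ≤ c + x → x * δ ≤ c * d → k * δ ≤ c * (d + δ)
k≤c+x∧x*δ≤c*d⇒k*δ≤c*[d+δ] {k} {c} {x} {δ} {d} k≤c+x xδ≤cd = begin
  k * δ          ≤⟨ *-monoˡ-≤ δ k≤c+x ⟩
  (c + x) * δ    ≡⟨ *-distribʳ-+ δ c x ⟩
  c * δ + x * δ  ≤⟨ +-monoʳ-≤ (c * δ) xδ≤cd ⟩
  c * δ + c * d  ≡⟨ +-comm (c * δ) (c * d) ⟩
  c * d + c * δ  ≡⟨ *-distribˡ-+ c d δ ⟨
  c * (d + δ)    ∎
  where open ≤-Reasoning

matching-bound : ∀ {n} {G : Graph n} {δ Δ-1 M D} →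
  (∀ v → δ ≤ deg G v) → (∀ v → deg G v ≤ suc Δ-1) →
  IsMatching G M → IsMaximalMatching G D → δ * length M ≤ length D * (Δ-1 + δ)
matching-bound {G = G} {δ} {Δ-1} {M} {D} δ≤deg deg≤Δ M-matching D-maximal =
  *-cancelˡ-≤ 2 (begin
    2 * (δ * length M)         ≡⟨ cong (2 *_) (*-comm δ (length M)) ⟩
    2 * (length M * δ)         ≡⟨ *-assoc 2 (length M) δ ⟨
    2 * length M * δ           ≡⟨ cong (_* δ) (size-covered G M-matching) ⟨
    size K * δ                 ≤⟨ k≤c+x∧x*δ≤c*d⇒k*δ≤c*[d+δ] {c = size C} (size-≤-∧-not K C)
                                    (size-uncovered*δ≤size-covered*[Δ-1] D-maximal A A-uncovered δ≤deg deg≤Δ) ⟩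
    size C * (Δ-1 + δ)         ≡⟨ cong (_* (Δ-1 + δ)) (size-covered G (proj₁ D-maximal)) ⟩
    2 * length D * (Δ-1 + δ)   ≡⟨ *-assoc 2 (length D) (Δ-1 + δ) ⟩
    2 * (length D * (Δ-1 + δ)) ∎)
  where
  open ≤-Reasoning
  K C A : Fin _ → Bool
  K = covered M
  C = covered D
  A v = K v ∧ not (C v)
  A-uncovered : ∀ a → A a ≡ true → C a ≡ false
  A-uncovered a _ with K a | C a
  A-uncovered a () | true  | true
  A-uncovered a () | false | _
  ... | true | false = refl

corollary2 : ∀ {n} (G : Graph n) (δ Δ μ γe : ℕ) →
    IsMinDegree G δ → IsMaxDegree G Δ → 1 ≤ δ →
    IsMatchingNumber G μ → IsEdgeDominationNumber G γe →
    δ * μ ≤ γe * (Δ + δ ∸ 1)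
-- Δ = 0 contradicts δ ≥ 1; for Δ = suc Δ-1 the truncated Δ + δ ∸ 1 computes to Δ-1 + δ.
corollary2 G δ zero μ γe ((v , deg-v≡δ) , _) (_ , deg≤0) 1≤δ _ _
  with () ← ≤-trans 1≤δ (≤-trans (≤-reflexive (sym deg-v≡δ)) (deg≤0 v))
corollary2 G δ (suc Δ-1) μ γe (_ , δ≤deg) (_ , deg≤Δ) _
  ((M , M-matching , refl) , _) ((D , D-maximal , refl) , _) =
  matching-bound δ≤deg deg≤Δ M-matching D-maximal
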